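{- For every $c\in \mathbb{N}$, every graph $G$, and every $A\subseteq V(G)$: $G[A]$ is a maximal $c$-atom of $G$ if and only if $A$ is maximal $c$-inseparable in $G$.
   Context: Graphs are finite, simple, undirected. A separation of $G$ is a pair $(A,B)$ with $A\cup B=V(G)$ and no edge between $A\setminus B$ and $B\setminus A$; it separates vertices $x,y$ if $x\in A\setminus B$, $y\in B\setminus A$. A clique separator (with clique separation $(A,B)$) is $A\cap B$ for a separation $(A,B)$ separating two vertices such that $G[A\cap B]$ is a clique (the empty set counts as a clique); its size is $|A\cap B|$. A $c$-atom is a graph containing no clique separator of size at most $c$. A maximal $c$-atom of $G$ is an induced subgraph $G[A]$ that is a $c$-atom and such that no $G[A']$ with $A\subsetneq A'\subseteq V(G)$ is a $c$-atom. Two vertices of $G$ are $c$-inseparable if no clique separator of size at most $c$ in $G$ separates them. A set $A\subseteq V(G)$ is $c$-inseparable if any two distinct vertices of $A$ are $c$-inseparable in $G$, and maximal $c$-inseparable if moreover no proper superset of $A$ in $V(G)$ is $c$-inseparable. -}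

module Defs where

open import Data.Nat using (ℕ; _≤_)
open import Data.Bool using (Bool; true; false)
open import Data.Fin using (Fin)
open import Data.Fin.Subset using (Subset; _∈_; _∉_; _⊆_; _⊂_; _∩_; _∪_; ∣_∣; ⊤)
open import Data.Product using (Σ; _×_; ∃; ∃-syntax)
open import Relation.Nullary using (¬_)
open import Relation.Binary.PropositionalEquality using (_≡_; _≢_)

record Graph (n : ℕ) : Set where
  field
    adj    : Fin n → Fin n → Bool
    sym    : ∀ x y → adj x y ≡ adj y x
    irrefl : ∀ x → adj x x ≡ false

module _ {n : ℕ} (G : Graph n) where
  open Graph G

  Edge : Fin n → Fin n → Set
  Edge x y = adj x y ≡ true

  IsClique : Subset n → Set
  IsClique S = ∀ x y → x ∈ S → y ∈ S → x ≢ y → Edge x y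

  IsSeparation : Subset n → Subset n → Subset n → Set
  IsSeparation V X Y =
    (X ∪ Y ≡ V) ×
    (∀ x y → x ∈ X → x ∉ Y → y ∈ Y → y ∉ X → ¬ Edge x y)

  SeparatesIn : Subset n → Subset n → Subset n → Fin n → Fin n → Set
  SeparatesIn V X Y x y =
    IsSeparation V X Y × (x ∈ X × x ∉ Y) × (y ∈ Y × y ∉ X)

  SmallCliqueSepIn : ℕ → Subset n → Subset n → Subset n → Fin n → Fin n → Set
  SmallCliqueSepIn c V X Y x y =
    SeparatesIn V X Y x y × IsClique (X ∩ Y) × (∣ X ∩ Y ∣ ≤ c)

  IsAtom : ℕ → Subset n → Set
  IsAtom c A = ¬ (∃[ X ] ∃[ Y ] ∃[ x ] ∃[ y ] SmallCliqueSepIn c A X Y x y)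

  IsMaximalAtom : ℕ → Subset n → Set
  IsMaximalAtom c A = IsAtom c A × (∀ A' → A ⊂ A' → ¬ IsAtom c A')

  Inseparable : ℕ → Fin n → Fin n → Set
  Inseparable c x y = ¬ (∃[ X ] ∃[ Y ] SmallCliqueSepIn c ⊤ X Y x y)

  IsInseparableSet : ℕ → Subset n → Set
  IsInseparableSet c A = ∀ x y → x ∈ A → y ∈ A → x ≢ y → Inseparable c x y

  IsMaximalInseparable : ℕ → Subset n → Set
  IsMaximalInseparable c A =
    IsInseparableSet c A × (∀ A' → A ⊂ A' → ¬ IsInseparableSet c A')

-- Two facts about a set A ⊆ V(G) carry the proof.
--  (1) If G[A] is a c-atom, then A is c-inseparable: a small clique
--      separation of G separating two vertices of A restricts to one of G[A].
--  (2) If A is maximal c-inseparable, then G[A] is a c-atom.  Suppose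
--      (X , Y) is a small clique separation of G[A] separating x and y, and
--      let S = X ∩ Y.  First, no walk of G − S runs from X ∖ Y to Y ∖ X:
--      along a shortest such walk p w ⋯ q, the vertex w lies in A by
--      maximality, because a small clique separation of G cutting w off
--      some vertex of A would give a shorter walk from p to q; and a first
--      step into A stays in X ∖ Y.  Hence the set R of vertices reachable
--      from x in G − S misses y, and (R ∪ S , ∁ R) is a small clique
--      separation of G separating x and y, contradicting inseparability.
-- The theorem follows: a maximal atom is inseparable by (1), and any
-- strictly larger inseparable set lies in a maximal one, an atom by (2);
-- conversely a maximal inseparable set is an atom by (2), and any strictly
-- larger atom would be inseparable by (1).
module Submission where

open import Defs
open import Data.Nat using (ℕ; zero; suc; _≤_; _<_; s≤s)
open import Data.Nat.Properties using (≤-trans; <⇒≤; n<1+n; m<n⇒m<1+n)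
open import Data.Nat.Induction using (<-rec)
open import Data.Bool using (true)
open import Data.Fin using (Fin; zero; suc)
open import Data.Fin.Properties using (_≟_)
open import Data.Fin.Subset
  using (Subset; _∈_; _∉_; _⊆_; _⊃_; _∩_; _∪_; ∁; ⁅_⁆; ∣_∣; ⊤)
open import Data.Fin.Subset.Properties
  using ( _∈?_; ∈⊤; ⊆⊤; ⊆-refl; ⊆-trans; ⊆-antisym; ⊂-⊆-trans; p⊆q⇒∣p∣≤∣q∣
        ; x∈p∩q⁺; x∈p∩q⁻; x∈p∪q⁺; x∈p∪q⁻; p⊆p∪q; ∪-comm; ∩-comm
        ; x∈⁅x⁆; x∈⁅y⁆⇒x≡y; x∈∁p⇒x∉p; x∉∁p⇒x∈p; x∉p⇒x∈∁p; x∈p⇒x∉∁p )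
open import Data.Fin.Subset.Induction using (⊃-wellFounded)
open import Data.Vec using (tabulate)
open import Data.Vec.Properties using (lookup⇒[]=; []=⇒lookup; lookup∘tabulate)
open import Data.Product using (Σ; ∃-syntax; _×_; _,_; proj₁; proj₂)
open import Data.Sum using (_⊎_; inj₁; inj₂)
open import Data.Empty using (⊥-elim)
open import Function using (_∘_)
open import Induction.WellFounded using (Acc; acc)
open import Relation.Nullary using (¬_; Dec; yes; no; does)
open import Relation.Nullary.Decidable using (dec-true; ¬¬-excluded-middle)
open import Relation.Binary.PropositionalEquality
  using (_≡_; refl; sym; trans; subst)

-- Excluded middle for finitely many propositions cannot be refuted; this
-- lets a proof of ⊥ treat reachability in a finite graph as decidable.
¬¬-decide-all : ∀ {m} (P : Fin m → Set) → ¬ ¬ (∀ v → Dec (P v))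
¬¬-decide-all {zero}  P k = k (λ ())
¬¬-decide-all {suc m} P k = ¬¬-excluded-middle λ dec₀ →
  ¬¬-decide-all (P ∘ suc) λ dec₊ → k λ { zero → dec₀ ; (suc v) → dec₊ v }

module _ {n : ℕ} {P : Fin n → Set} (P? : ∀ v → Dec (P v)) where

  decided : Subset n
  decided = tabulate (λ v → does (P? v))

  ∈-decided⁺ : ∀ {v} → P v → v ∈ decided
  ∈-decided⁺ {v} pv =
    lookup⇒[]= v decided (trans (lookup∘tabulate _ v) (dec-true (P? v) pv))

  ∈-decided⁻ : ∀ {v} → v ∈ decided → P v
  ∈-decided⁻ {v} v∈ = witness (P? v) (trans (sym (lookup∘tabulate _ v)) ([]=⇒lookup v∈))
    where
    witness : (d : Dec (P v)) → does d ≡ true → P v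
    witness (yes pv) _ = pv

module _ {n : ℕ} {X Y V : Subset n} (cover : X ∪ Y ≡ V) where

  ∈-cover⁺ : ∀ {v} → v ∈ X ⊎ v ∈ Y → v ∈ V
  ∈-cover⁺ = subst (_ ∈_) cover ∘ x∈p∪q⁺

  ∈-cover⁻ : ∀ {v} → v ∈ V → v ∈ X ⊎ v ∈ Y
  ∈-cover⁻ v∈V = x∈p∪q⁻ X Y (subst (_ ∈_) (sym cover) v∈V)

module _ {n : ℕ} (G : Graph n) (c : ℕ) where

  edge-sym : ∀ {u w} → Edge G u w → Edge G w u
  edge-sym {u} {w} e = trans (sym (Graph.sym G u w)) e

  swap-sep : ∀ {V X Y x y} →
    SmallCliqueSepIn G c V X Y x y → SmallCliqueSepIn G c V Y X y x
  swap-sep {X = X} {Y} (((cover , noEdge) , x-side , y-side) , clique , size) =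
    ( (trans (∪-comm Y X) cover , λ a b aY aX bX bY → noEdge b a bX bY aY aX ∘ edge-sym)
    , y-side , x-side )
    , subst (IsClique G) (∩-comm X Y) clique
    , subst (λ s → ∣ s ∣ ≤ c) (∩-comm X Y) size

  inseparable-sym : ∀ {x y} → Inseparable G c x y → Inseparable G c y x
  inseparable-sym insep (X , Y , sep) = insep (Y , X , swap-sep sep)

  neighbour-side : ∀ {X Y z t} → IsSeparation G ⊤ X Y →
    z ∈ X → z ∉ Y → Edge G z t → t ∈ X
  neighbour-side {X} {Y} {z} {t} (cover , noEdge) zX zY e with ∈-cover⁻ cover ∈⊤
  ... | inj₁ tX = tX
  ... | inj₂ tY with t ∈? X
  ...   | yes tX = tX
  ...   | no  tX = ⊥-elim (noEdge z t zX zY tY tX e)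

  ∈-separator : ∀ {X Y : Subset n} {v} → v ∈ X → ¬ (v ∈ X × v ∉ Y) → v ∈ X ∩ Y
  ∈-separator {Y = Y} {v} vX notStrict with v ∈? Y
  ... | yes vY = x∈p∩q⁺ (vX , vY)
  ... | no  vY = ⊥-elim (notStrict (vX , vY))

  restrict-sep : ∀ {V A X Y x y} → A ⊆ V → x ∈ A → y ∈ A →
    SmallCliqueSepIn G c V X Y x y → SmallCliqueSepIn G c A (X ∩ A) (Y ∩ A) x y
  restrict-sep {A = A} {X = X} {Y = Y} A⊆V xA yA
               (((cover , noEdge) , (xX , xY) , (yY , yX)) , clique , size) =
    ( (cover' , noEdge')
    , (x∈p∩q⁺ (xX , xA) , xY ∘ proj₁ ∘ x∈p∩q⁻ Y A)
    , (x∈p∩q⁺ (yY , yA) , yX ∘ proj₁ ∘ x∈p∩q⁻ X A) )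
    , (λ u w u∈ w∈ → clique u w (shrink u∈) (shrink w∈))
    , ≤-trans (p⊆q⇒∣p∣≤∣q∣ shrink) size
    where
    shrink : (X ∩ A) ∩ (Y ∩ A) ⊆ X ∩ Y
    shrink v∈ with x∈p∩q⁻ (X ∩ A) (Y ∩ A) v∈
    ... | vXA , vYA = x∈p∩q⁺ (proj₁ (x∈p∩q⁻ X A vXA) , proj₁ (x∈p∩q⁻ Y A vYA))
    cover' : (X ∩ A) ∪ (Y ∩ A) ≡ A
    cover' = ⊆-antisym into onto
      where
      into : (X ∩ A) ∪ (Y ∩ A) ⊆ A
      into v∈ with x∈p∪q⁻ (X ∩ A) (Y ∩ A) v∈
      ... | inj₁ vXA = proj₂ (x∈p∩q⁻ X A vXA)
      ... | inj₂ vYA = proj₂ (x∈p∩q⁻ Y A vYA)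
      onto : A ⊆ (X ∩ A) ∪ (Y ∩ A)
      onto vA with ∈-cover⁻ cover (A⊆V vA)
      ... | inj₁ vX = x∈p∪q⁺ (inj₁ (x∈p∩q⁺ (vX , vA)))
      ... | inj₂ vY = x∈p∪q⁺ (inj₂ (x∈p∩q⁺ (vY , vA)))
    noEdge' : ∀ u w → u ∈ X ∩ A → u ∉ Y ∩ A → w ∈ Y ∩ A → w ∉ X ∩ A → ¬ Edge G u w
    noEdge' u w uXA uYA wYA wXA with x∈p∩q⁻ X A uXA | x∈p∩q⁻ Y A wYA
    ... | uX , uA | wY , wA =
      noEdge u w uX (λ uY → uYA (x∈p∩q⁺ (uY , uA))) wY (λ wX → wXA (x∈p∩q⁺ (wX , wA)))

  atom⇒inseparable : ∀ {A} → IsAtom G c A → IsInseparableSet G c A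
  atom⇒inseparable atom x y xA yA _ (X , Y , sep) =
    atom (_ , _ , x , y , restrict-sep ⊆⊤ xA yA sep)

  extend-inseparable : ∀ {A w} → IsInseparableSet G c A →
    (∀ a → a ∈ A → Inseparable G c w a) → IsInseparableSet G c (A ∪ ⁅ w ⁆)
  extend-inseparable {A} {w} insA w-insep u v u∈ v∈ u≢v
    with x∈p∪q⁻ A ⁅ w ⁆ u∈ | x∈p∪q⁻ A ⁅ w ⁆ v∈
  ... | inj₁ uA | inj₁ vA = insA u v uA vA u≢v
  ... | inj₂ uw | inj₁ vA rewrite x∈⁅y⁆⇒x≡y w uw = w-insep v vA
  ... | inj₁ uA | inj₂ vw rewrite x∈⁅y⁆⇒x≡y w vw = inseparable-sym (w-insep u uA)
  ... | inj₂ uw | inj₂ vw = ⊥-elim (u≢v (trans (x∈⁅y⁆⇒x≡y w uw) (sym (x∈⁅y⁆⇒x≡y w vw))))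

  maximal-absorbs : ∀ {A w} → IsMaximalInseparable G c A →
    (∀ a → a ∈ A → Inseparable G c w a) → w ∈ A
  maximal-absorbs {A} {w} (insA , maxA) w-insep with w ∈? A
  ... | yes wA = wA
  ... | no  wA = ⊥-elim (maxA (A ∪ ⁅ w ⁆) (p⊆p∪q ⁅ w ⁆ , w , x∈p∪q⁺ (inj₂ (x∈⁅x⁆ w)) , wA)
                              (extend-inseparable insA w-insep))

  data Walk (S : Subset n) : Fin n → Fin n → ℕ → Set where
    nil  : ∀ {u} → u ∉ S → Walk S u u 0
    cons : ∀ {u w v k} → u ∉ S → Edge G u w → Walk S w v k → Walk S u v (suc k)

  start-avoids : ∀ {S u v k} → Walk S u v k → u ∉ S
  start-avoids (nil u∉S)      = u∉S
  start-avoids (cons u∉S _ _) = u∉S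

  snoc : ∀ {S u v w k} → Walk S u v k → Edge G v w → w ∉ S → Walk S u w (suc k)
  snoc (nil u∉S)        e w∉S = cons u∉S e (nil w∉S)
  snoc (cons u∉S e′ W)  e w∉S = cons u∉S e′ (snoc W e w∉S)

  leave : ∀ {S} (Z : Fin n → Set) (Z? : ∀ v → Dec (Z v)) {u q k} →
    Walk S u q k → Z u → ¬ Z q →
    Σ (Fin n) λ z → Σ (Fin n) λ t → Σ ℕ λ k′ →
      Z z × ¬ Z t × Edge G z t × Walk S t q k′ × k′ < k
  leave Z Z? (nil _) zu ¬zq = ⊥-elim (¬zq zu)
  leave Z Z? {u} (cons {w = w} {k = k} _ e W) zu ¬zq with Z? w
  ... | no ¬zw = u , w , k , zu , ¬zw , e , W , n<1+n k
  ... | yes zw with leave Z Z? W zw ¬zq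
  ...   | z , t , k′ , zz , ¬zt , e′ , W′ , k′<k =
          z , t , k′ , zz , ¬zt , e′ , W′ , m<n⇒m<1+n k′<k

  -- Let A be inseparable, p, q, a ∈ A and p w ⋯ q
  -- a walk in G − S.  If a small clique separation (X′ , Y′) of G puts w
  -- in X′ ∖ Y′ and a in Y′ ∖ X′, then the walk w ⋯ q must leave X′ ∖ Y′
  -- (q, like every vertex of A, is not in it) into the clique X′ ∩ Y′,
  -- which also contains p; this yields a walk from p to q in G − S no
  -- longer than w ⋯ q.
  shortcut : ∀ {A S X′ Y′ p q w a k} → IsInseparableSet G c A →
    p ∈ A → q ∈ A → a ∈ A → p ∉ S → Edge G p w → Walk S w q k →
    SmallCliqueSepIn G c ⊤ X′ Y′ w a → ∃[ k′ ] (k′ ≤ k × Walk S p q k′)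
  shortcut {A} {S} {X′} {Y′} {p} {q} {a = a} {k = k} insA pA qA aA p∉S e W
           ((separation , w-side , (aY′ , aX′)) , clique , size) = exit
    where
    Strict : Fin n → Set
    Strict v = v ∈ X′ × v ∉ Y′
    Strict? : ∀ v → Dec (Strict v)
    Strict? v with v ∈? X′ | v ∈? Y′
    ... | yes vX′ | no vY′ = yes (vX′ , vY′)
    ... | no vX′  | _      = no (vX′ ∘ proj₁)
    ... | yes _   | yes vY′ = no (λ s → proj₂ s vY′)
    -- No vertex of A lies strictly on the X′ side, as it would be
    -- separated from a.
    A-not-strict : ∀ {b} → b ∈ A → ¬ Strict b
    A-not-strict {b} bA (bX′ , bY′) =
      insA b a bA aA (λ { refl → aX′ bX′ })
        (X′ , Y′ , ((separation , (bX′ , bY′) , (aY′ , aX′)) , clique , size))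
    p-sep : p ∈ X′ ∩ Y′
    p-sep = ∈-separator (neighbour-side separation (proj₁ w-side) (proj₂ w-side) (edge-sym e))
                        (A-not-strict pA)
    exit : ∃[ k′ ] (k′ ≤ k × Walk S p q k′)
    exit with leave Strict Strict? W w-side (A-not-strict qA)
    ... | z , t , k′ , (zX′ , zY′) , ¬zt , zt , W′ , k′<k with t ≟ p
    ...   | yes refl = k′ , <⇒≤ k′<k , W′
    ...   | no  t≢p  = suc k′ , k′<k , cons p∉S (clique p t p-sep t-sep (t≢p ∘ sym)) W′
      where
      t-sep : t ∈ X′ ∩ Y′
      t-sep = ∈-separator (neighbour-side separation zX′ zY′ zt) ¬zt

  -- By induction on the length: the second vertex w lies in A by
  -- maximality (a separation of w from A would give a shorter crossing walk
  -- via `shortcut`), and then w ∈ X ∖ Y, as an edge into Y ∖ X is excluded.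
  no-crossing-walk : ∀ {A X Y} → IsMaximalInseparable G c A → IsSeparation G A X Y →
    ∀ k {p q} → p ∈ X → p ∉ Y → q ∈ Y → q ∉ X → ¬ Walk (X ∩ Y) p q k
  no-crossing-walk {A} {X} {Y} maxIns@(insA , _) (cover , noEdge) = <-rec Crossing step
    where
    Crossing : ℕ → Set
    Crossing k = ∀ {p q} → p ∈ X → p ∉ Y → q ∈ Y → q ∉ X → ¬ Walk (X ∩ Y) p q k
    step : ∀ k → (∀ {k′} → k′ < k → Crossing k′) → Crossing k
    step _ _ pX pY qY qX (nil _) = pY qY
    step (suc k) shorter {p} {q} pX pY qY qX (cons {w = w} p∉S e W)
      with ∈-cover⁻ cover (maximal-absorbs maxIns w-insep)
      where
      w-insep : ∀ a → a ∈ A → Inseparable G c w a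
      w-insep a aA (X′ , Y′ , sep) with shortcut insA (∈-cover⁺ cover (inj₁ pX))
                                          (∈-cover⁺ cover (inj₂ qY)) aA p∉S e W sep
      ... | k′ , k′≤k , W′ = shorter (s≤s k′≤k) pX pY qY qX W′
    ... | inj₁ wX = shorter (n<1+n k) wX (λ wY → start-avoids W (x∈p∩q⁺ (wX , wY))) qY qX W
    ... | inj₂ wY = noEdge p w pX pY wY (λ wX → start-avoids W (x∈p∩q⁺ (wX , wY))) e

  closed-set-separates : ∀ {R S x y} →
    (∀ {u w} → u ∈ R → Edge G u w → w ∉ S → w ∈ R) →
    IsClique G S → ∣ S ∣ ≤ c → x ∈ R → x ∉ S → y ∉ R → y ∉ S →
    SmallCliqueSepIn G c ⊤ (R ∪ S) (∁ R) x y
  closed-set-separates {R} {S} {x} {y} closed clique size xR x∉S yR y∉S =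
    ( (cover , noEdge)
    , (x∈p∪q⁺ (inj₁ xR) , x∈p⇒x∉∁p xR)
    , (x∉p⇒x∈∁p yR , y∉R∪S) )
    , (λ u w u∈ w∈ → clique u w (separator⊆S u∈) (separator⊆S w∈))
    , ≤-trans (p⊆q⇒∣p∣≤∣q∣ separator⊆S) size
    where
    separator⊆S : (R ∪ S) ∩ ∁ R ⊆ S
    separator⊆S v∈ with x∈p∩q⁻ (R ∪ S) (∁ R) v∈
    ... | vRS , v∁R with x∈p∪q⁻ R S vRS
    ...   | inj₁ vR = ⊥-elim (x∈∁p⇒x∉p v∁R vR)
    ...   | inj₂ vS = vS
    y∉R∪S : y ∉ R ∪ S
    y∉R∪S y∈ with x∈p∪q⁻ R S y∈
    ... | inj₁ y∈R = yR y∈R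
    ... | inj₂ y∈S = y∉S y∈S
    cover : (R ∪ S) ∪ ∁ R ≡ ⊤
    cover = ⊆-antisym ⊆⊤ λ {v} _ → side v
      where
      side : ∀ v → v ∈ (R ∪ S) ∪ ∁ R
      side v with v ∈? R
      ... | yes vR = x∈p∪q⁺ (inj₁ (x∈p∪q⁺ (inj₁ vR)))
      ... | no  vR = x∈p∪q⁺ (inj₂ (x∉p⇒x∈∁p vR))
    noEdge : ∀ u w → u ∈ R ∪ S → u ∉ ∁ R → w ∈ ∁ R → w ∉ R ∪ S → ¬ Edge G u w
    noEdge u w _ u∉∁R w∈∁R w∉RS e =
      x∈∁p⇒x∉p w∈∁R (closed (x∉∁p⇒x∈p u∉∁R) e (w∉RS ∘ x∈p∪q⁺ ∘ inj₂))

  -- Claim (2): the set R of vertices reachable from x in G − (X ∩ Y) does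
  -- not contain y, so it separates x from y in G.
  maxInseparable⇒atom : ∀ {A} → IsMaximalInseparable G c A → IsAtom G c A
  maxInseparable⇒atom maxIns@(insA , _)
      (X , Y , x , y , sep@((cover , _) , (xX , xY) , (yY , yX)) , clique , size) =
    ¬¬-decide-all Reachable λ reachable? →
      insA x y (∈-cover⁺ cover (inj₁ xX)) (∈-cover⁺ cover (inj₂ yY)) (λ { refl → xY yY })
        (_ , _ , closed-set-separates (closed reachable?) clique size
                   (∈-decided⁺ reachable? (0 , nil x∉S)) x∉S
                   (λ y∈ → unreachable (∈-decided⁻ reachable? y∈))
                   (yX ∘ proj₁ ∘ x∈p∩q⁻ X Y))
    where
    S : Subset n
    S = X ∩ Y
    x∉S : x ∉ S
    x∉S = xY ∘ proj₂ ∘ x∈p∩q⁻ X Y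
    Reachable : Fin n → Set
    Reachable v = ∃[ k ] Walk S x v k
    unreachable : ¬ Reachable y
    unreachable (k , W) = no-crossing-walk maxIns (proj₁ sep) k xX xY yY yX W
    closed : (reachable? : ∀ v → Dec (Reachable v)) →
      ∀ {u w} → u ∈ decided reachable? → Edge G u w → w ∉ S → w ∈ decided reachable?
    closed reachable? u∈ e w∉S with ∈-decided⁻ reachable? u∈
    ... | k , W = ∈-decided⁺ reachable? (suc k , snoc W e w∉S)

  -- Every inseparable set lies in a maximal one; in negative form, by
  -- well-founded induction along strict supersets.
  inseparable-below-maximal : ∀ {A} → Acc _⊃_ A →
    (∀ B → A ⊆ B → ¬ IsMaximalInseparable G c B) → ¬ IsInseparableSet G c A
  inseparable-below-maximal {A} (acc larger) noneAbove insA =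
    noneAbove A ⊆-refl
      (insA , λ A′ A⊂A′ → inseparable-below-maximal (larger A⊂A′)
                             (λ B A′⊆B → noneAbove B (⊆-trans (proj₁ A⊂A′) A′⊆B)))

  -- Forward direction: a strictly larger inseparable set would lie in a
  -- maximal one, which is an atom strictly containing A.
  maxAtom⇒maxInseparable : ∀ {A} → IsMaximalAtom G c A → IsMaximalInseparable G c A
  maxAtom⇒maxInseparable (atom , maxAtom) =
    atom⇒inseparable atom ,
    λ A′ A⊂A′ → inseparable-below-maximal (⊃-wellFounded A′)
      (λ B A′⊆B maxB → maxAtom B (⊂-⊆-trans A⊂A′ A′⊆B) (maxInseparable⇒atom maxB))

  -- Backward direction: a strictly larger atom would be inseparable.
  maxInseparable⇒maxAtom : ∀ {A} → IsMaximalInseparable G c A → IsMaximalAtom G c A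
  maxInseparable⇒maxAtom maxIns@(_ , maxA) =
    maxInseparable⇒atom maxIns ,
    λ A′ A⊂A′ atom′ → maxA A′ A⊂A′ (atom⇒inseparable atom′)

lemma5 : (c n : ℕ) (G : Graph n) (A : Subset n) →
    (IsMaximalAtom G c A → IsMaximalInseparable G c A) ×
    (IsMaximalInseparable G c A → IsMaximalAtom G c A)
lemma5 c n G A = maxAtom⇒maxInseparable G c , maxInseparable⇒maxAtom G c
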